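{- Let $M$ be a finite ordinal monoid, $\Sigma$ a finite alphabet and $\mu:\Sigma\to M$. Then $(\mathcal P(M),\{1\},\subseteq,\cdot,-^\omega,-^{\mathrm{merge}})$ and $(\mathrm{Sat},\{1\},\subseteq,\cdot,-^\omega,-^{\mathrm{merge}})$ (with operations of the power ordinal monoid) are ordinal monoids with merge.
   Context: An ordinal monoid is $(M,\pi)$ with $\pi:M^{\mathrm{ord}}\to M$ on countable ordinal words, $\pi(x)=x$ on one-letter words, and generalised associativity. Write $1=\pi(\varepsilon)$, $x\cdot y=\pi(xy)$, $x^\omega=\pi(xxx\cdots)$; finite ordinal monoids are determined by these. The power ordinal monoid $\mathcal P(M)$ has product $\pi((X_\iota)_\iota)=\{\pi((x_\iota)_\iota):x_\iota\in X_\iota\}$; concretely $X\cdot Y=\{xy\}$, $X^\omega=\{u\cdot v^\omega:u,v\in X^+\}$. For $x$ in a finite semigroup, $x^{\mathrm{idem}}$ is its idempotent power and $x^{\mathrm{idem}+k}$ the eventual value of $x^{n!+k}$; $X^{\mathrm{merge}}=\bigcup_{k\in\mathbb N}X^{\mathrm{idem}+k}$ in $\mathcal P(M)$. $\mathrm{Sat}$ is the least subset of $\mathcal P(M)$ containing $\{1\}$ and all $\{\mu(a)\}$, closed under $\cdot$, $-^\omega$, $-^{\mathrm{merge}}$. An ordered ordinal monoid has a partial order $\leqslant$ with $\pi$ monotone for the letterwise order. A finite ordinal monoid with merge is a finite ordered ordinal monoid $(M,1,\leqslant,\cdot,-^\omega)$ with a monotone $-^{\mathrm{merge}}:M\to M$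 such that for all $a,b$ and integers $k$: $a^{\mathrm{idem}+k}\leqslant a^{\mathrm{merge}}$, $(a^{\mathrm{idem}})^{\mathrm{merge}}=a^{\mathrm{idem}}$, $a^{\mathrm{merge}}a^{\mathrm{merge}}=(a^{\mathrm{merge}})^{\mathrm{merge}}=a^{\mathrm{merge}}$, $(ab)^{\mathrm{merge}}=a(ba)^{\mathrm{merge}}b$. -}

module Defs where

open import Data.Nat using (ℕ; zero; suc; _+_; _≤_; _^_; _!)
open import Data.Integer as ℤ using (ℤ; +_)
open import Data.Fin using (Fin)
open import Data.Fin.Properties using (any?)
open import Data.Fin.Subset using (Subset; _∪_; ⋃; ⁅_⁆; _⊆_; _∈_)
open import Data.Fin.Subset.Properties using (_∈?_)
open import Data.Vec using (tabulate)
open import Data.List using (map; upTo)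
open import Data.Product using (Σ; ∃; ∃-syntax; _×_; _,_; proj₁)
open import Relation.Nullary using (does)
open import Relation.Nullary.Decidable using (_×-dec_)
open import Relation.Binary using (Rel; IsEquivalence; IsPartialOrder)
open import Relation.Binary.PropositionalEquality using (_≡_)
open import Algebra.Core using (Op₁; Op₂)

iter : {A : Set} → (A → A) → A → ℕ → A
iter f a zero    = a
iter f a (suc k) = f (iter f a k)

pow : {A : Set} → A → Op₂ A → A → ℕ → A
pow one _∙_ x zero    = one
pow one _∙_ x (suc k) = x ∙ pow one _∙_ x k

-- IsIdemPlus x k y  :  y is x^{idem+k}, i.e. y is the eventual value of
-- x^{m!+k} (k an integer; for large m the exponent m!+k is a natural).
-- x^idem is the case k = 0.
IsIdemPlus : {A : Set} → Rel A _ → A → Op₂ A → A → ℤ → A → Set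
IsIdemPlus _≈_ one _∙_ x k y =
  ∃[ m₀ ] ∀ m → m₀ ≤ m → ∀ e → + e ≡ (+ (m !)) ℤ.+ k → pow one _∙_ x e ≈ y

IsFinite : {A : Set} → Rel A _ → Set
IsFinite {A} _≈_ = ∃[ N ] Σ (Fin N → A) λ f → ∀ a → ∃[ i ] f i ≈ a

-- A finite ordinal monoid, given by (M, 1, ·, -^ω) (which determine π in
-- the finite case), with the equations characterising those finite
-- (1, ·, ω)-algebras that come from an ordinal monoid (Bedon–Carton).
record IsFiniteOrdinalMonoid {A : Set} (_≈_ : Rel A _) (one : A)
         (_∙_ : Op₂ A) (ω : Op₁ A) : Set where
  field
    isEquivalence : IsEquivalence _≈_
    ∙-cong   : ∀ {x x′ y y′} → x ≈ x′ → y ≈ y′ → (x ∙ y) ≈ (x′ ∙ y′)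
    ω-cong   : ∀ {x y} → x ≈ y → ω x ≈ ω y
    finite   : IsFinite _≈_
    assoc    : ∀ x y z → ((x ∙ y) ∙ z) ≈ (x ∙ (y ∙ z))
    identityˡ : ∀ x → (one ∙ x) ≈ x
    identityʳ : ∀ x → (x ∙ one) ≈ x
    ω-swap   : ∀ x y → ω (x ∙ y) ≈ (x ∙ ω (y ∙ x))
    ω-pow    : ∀ x k → ω (pow one _∙_ x (suc k)) ≈ ω x
    ω-one    : ω one ≈ one

record IsFiniteOrdinalMonoidWithMerge {A : Set} (_≈_ _≤_ : Rel A _) (one : A)
         (_∙_ : Op₂ A) (ω merge : Op₁ A) : Set where
  field
    isFiniteOrdinalMonoid : IsFiniteOrdinalMonoid _≈_ one _∙_ ω
    isPartialOrder : IsPartialOrder _≈_ _≤_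
    -- ordered: π monotone, i.e. · and ω monotone
    ∙-mono   : ∀ {x x′ y y′} → x ≤ x′ → y ≤ y′ → (x ∙ y) ≤ (x′ ∙ y′)
    ω-mono   : ∀ {x y} → x ≤ y → ω x ≤ ω y
    merge-cong : ∀ {x y} → x ≈ y → merge x ≈ merge y
    merge-mono : ∀ {x y} → x ≤ y → merge x ≤ merge y
    idemPlus≤merge : ∀ a (k : ℤ) y → IsIdemPlus _≈_ one _∙_ a k y → y ≤ merge a
    merge-idem : ∀ a e → IsIdemPlus _≈_ one _∙_ a (+ 0) e → merge e ≈ e
    merge-∙-merge : ∀ a → (merge a ∙ merge a) ≈ merge a
    merge-merge : ∀ a → merge (merge a) ≈ merge a
    merge-shift : ∀ a b → merge (a ∙ b) ≈ (a ∙ (merge (b ∙ a) ∙ b))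

record FiniteOrdinalMonoid (n : ℕ) : Set where
  field
    one : Fin n
    _∙_ : Op₂ (Fin n)
    ω   : Op₁ (Fin n)
    isFiniteOrdinalMonoid : IsFiniteOrdinalMonoid _≡_ one _∙_ ω

module Power {n : ℕ} (M : FiniteOrdinalMonoid n) where
  open FiniteOrdinalMonoid M renaming (one to 1M; _∙_ to _∙M_; ω to ωM)
  open import Data.Fin using (_≟_)

  oneP : Subset n
  oneP = ⁅ 1M ⁆

  _·P_ : Op₂ (Subset n)
  X ·P Y = tabulate λ z →
    does (any? λ x → any? λ y → (x ∈? X) ×-dec ((y ∈? Y) ×-dec ((x ∙M y) ≟ z)))

  -- X⁺ = ⋃_{k ≥ 1} X^k, computed as X ∪ X² ∪ … ∪ X^{n+1}
  -- (the increasing chain of partial unions is stationary from there on).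
  plusP : Op₁ (Subset n)
  plusP X = iter (λ Y → Y ∪ (Y ·P X)) X n

  ωP : Op₁ (Subset n)
  ωP X = tabulate λ z →
    does (any? λ u → any? λ v →
      (u ∈? plusP X) ×-dec ((v ∈? plusP X) ×-dec ((u ∙M ωM v) ≟ z)))

  powP : Subset n → ℕ → Subset n
  powP = pow oneP _·P_

  -- N = |P(M)|; for k ∈ ℕ, X^{idem+k} = X^{N!+k} (N! ≥ N and every period
  -- divides N!), and X^merge = ⋃_{k ∈ ℕ} X^{idem+k} = ⋃_{k < N!} X^{N!+k}.
  N : ℕ
  N = 2 ^ n

  mergeP : Op₁ (Subset n)
  mergeP X = ⋃ (map (λ k → powP X ((N !) + k)) (upTo (N !)))

  data InSat {m : ℕ} (μ : Fin m → Fin n) : Subset n → Set where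
    sat-one   : InSat μ oneP
    sat-μ     : ∀ a → InSat μ ⁅ μ a ⁆
    sat-·     : ∀ {X Y} → InSat μ X → InSat μ Y → InSat μ (X ·P Y)
    sat-ω     : ∀ {X} → InSat μ X → InSat μ (ωP X)
    sat-merge : ∀ {X} → InSat μ X → InSat μ (mergeP X)

  module SatStr {m : ℕ} (μ : Fin m → Fin n) where
    Sat : Set
    Sat = Σ (Subset n) (InSat μ)

    _≈S_ : Rel Sat _
    X ≈S Y = proj₁ X ≡ proj₁ Y

    _⊆S_ : Rel Sat _
    X ⊆S Y = proj₁ X ⊆ proj₁ Y

    oneS : Sat
    oneS = oneP , sat-one

    _·S_ : Op₂ Sat
    (X , p) ·S (Y , q) = (X ·P Y) , sat-· p q

    ωS : Op₁ Sat
    ωS (X , p) = ωP X , sat-ω p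

    mergeS : Op₁ Sat
    mergeS (X , p) = mergeP X , sat-merge p

{-# OPTIONS --safe #-}
-- Every law of M lifts to P(M) by chasing witnesses through the pointwise definition of
-- the set operations; the ω-laws use the rotation u · ω (a · b) = (u · a) · ω (b · a).
-- The powers of a set X are the orbit of X ·_ on the 2 ^ n-element set P(M), so they
-- are periodic from N = 2 ^ n on with period dividing N!.  Hence the finite union
-- defining X^merge contains every X^e with e ≥ N!, and the merge laws become identities
-- between powers.  Likewise X⁺ is the n-th stage of X ⊆ X ∪ X·X ⊆ …, which closes
-- within n steps, and Sat is finite because closing the generators under ·, ω and
-- merge, one round at a time on lists of subsets, stabilises within 2 ^ n rounds.
module Submission where

open import Defs
open import Algebra.Core using (Op₂)
open import Algebra.Structures using (IsMonoid)
open import Data.Bool as Bool using (Bool; true; false)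
open import Data.Empty using (⊥-elim)
open import Data.Fin as Fin using (Fin; zero; suc; toℕ; remQuot; combine)
open import Data.Fin.Properties as Finₚ using (toℕ<n; any?; injective⇒≤; remQuot-combine)
open import Data.Fin.Subset using (Subset; _∈_; _⊆_; _∪_; ⋃; ⁅_⁆)
open import Data.Fin.Subset.Properties
  using (_∈?_; x∈p∪q⁺; x∈p∪q⁻; ∉⊥; x∈⁅x⁆; x∈⁅y⁆⇒x≡y; ⊆-antisym; ⊆-reflexive; ⊆-isPartialOrder)
open import Data.Integer as ℤ using (ℤ; +_; -[1+_])
open import Data.Integer.Properties using (⊖-≥)
open import Data.List using (List; []; _∷_; _++_; length; lookup; map; upTo; allFin; cartesianProductWith)
open import Data.List.Membership.Propositional using () renaming (_∈_ to _∈ₗ_)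
open import Data.List.Membership.Propositional.Properties
  using (∈-lookup; ∈-map⁺; ∈-map⁻; ∈-upTo⁺; ∈-++⁺ˡ; ∈-++⁺ʳ; ∈-++⁻; ∈-allFin;
         ∈-cartesianProductWith⁺; ∈-cartesianProductWith⁻)
import Data.List.Membership.DecPropositional as DecMembership
open import Data.List.Relation.Binary.Subset.Propositional using () renaming (_⊆_ to _⊆ₗ_)
open import Data.List.Relation.Binary.Subset.Propositional.Properties using (++⁺; map⁺)
open import Data.List.Relation.Unary.Any as Any using (here; there)
open import Data.List.Relation.Unary.Any.Properties using (lookup-index)
open import Data.Nat using (ℕ; zero; suc; _+_; _*_; _∸_; _≤_; _<_; _^_; _!; z≤n; z<s; NonZero; >-nonZero⁻¹)
open import Data.Nat.DivMod using (_/_; _%_; m%n<n; m≡m%n+[m/n]*n)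
open import Data.Nat.Divisibility using (_∣_; divides; ∣-trans; m∣m*n; m≤n⇒m!∣n!)
open import Data.Nat.Properties
  using (≤-refl; ≤-trans; ≤-pred; <⇒≤; n<1+n; n≤1+n; 1+n≰n; m≤m+n; m≤n+m; m≤m*n;
         +-comm; +-assoc; +-identityʳ; +-suc; *-comm; *-assoc; *-zeroʳ; *-suc;
         m∸n+n≡m; m∸n≤m; m<n⇒0<n∸m; m+n≤o⇒m≤o∸n; _!≢0)
open import Data.Nat.Solver using (module +-*-Solver)
open import Data.Product using (∃; ∃₂; Σ; _×_; _,_; proj₁; proj₂)
open import Data.Sum using (_⊎_; inj₁; inj₂)
open import Data.Vec using ([]; _∷_; tabulate)
open import Data.Vec.Functional using () renaming (_∷_ to _◂_)
open import Data.Vec.Properties using (lookup∘tabulate; lookup⇒[]=; []=⇒lookup; ≡-dec)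
open import Function using (_∘_; id; case_of_)
open import Function.Definitions using (Injective)
import Relation.Binary.Construct.On as On
open import Relation.Binary.PropositionalEquality
open import Relation.Nullary using (Dec; yes; no; does; proof; ¬_; contradiction)
open import Relation.Nullary.Decidable using (_×-dec_; ¬?; decidable-stable; dec-true)
open import Relation.Nullary.Reflects using (Reflects; invert)
import Relation.Unary as Unary

m∣n! : ∀ {m n} → 0 < m → m ≤ n → m ∣ n !
m∣n! {suc m} _ m≤n = ∣-trans (m∣m*n (m !)) (m≤n⇒m!∣n! m≤n)

n≤n! : ∀ n → n ≤ n !
n≤n! zero    = z≤n
n≤n! (suc n) = m≤m*n (suc n) (n !) {{n !≢0}}

factorial-offset : ∀ (k : ℤ) m₀ B → ∃₂ λ m e → m₀ ≤ m × B ≤ e × + e ≡ + (m !) ℤ.+ k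
factorial-offset (+ j) m₀ B =
  m₀ + B , (m₀ + B) ! + j , m≤m+n m₀ B ,
  ≤-trans (≤-trans (m≤n+m B m₀) (n≤n! (m₀ + B))) (m≤m+n _ j) , refl
factorial-offset -[1+ j ] m₀ B =
  m₀ + (B + suc j) , (m₀ + (B + suc j)) ! ∸ suc j , m≤m+n m₀ _ ,
  m+n≤o⇒m≤o∸n B B+j≤m! , sym (⊖-≥ (≤-trans (m≤n+m (suc j) B) B+j≤m!))
  where
  B+j≤m! : B + suc j ≤ (m₀ + (B + suc j)) !
  B+j≤m! = ≤-trans (m≤n+m _ m₀) (n≤n! _)

module _ {A : Set} (f : A → A) (a : A) where

  iter-+ : ∀ m n → iter f a (m + n) ≡ iter f (iter f a n) m
  iter-+ zero    n = refl
  iter-+ (suc m) n = cong f (iter-+ m n)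

  iter-cycle : ∀ {s p} → iter f a (p + s) ≡ iter f a s →
               ∀ r d → iter f a (r * p + (d + s)) ≡ iter f a (d + s)
  iter-cycle         loop zero    d = refl
  iter-cycle {s} {p} loop (suc r) d = begin
    iter f a ((p + r * p) + (d + s))      ≡⟨ cong (iter f a) (regroup p (r * p) d s) ⟩
    iter f a ((r * p + d) + (p + s))      ≡⟨ iter-+ (r * p + d) (p + s) ⟩
    iter f (iter f a (p + s)) (r * p + d) ≡⟨ cong (λ x → iter f x (r * p + d)) loop ⟩
    iter f (iter f a s) (r * p + d)       ≡⟨ iter-+ (r * p + d) s ⟨
    iter f a ((r * p + d) + s)            ≡⟨ cong (iter f a) (+-assoc (r * p) d s) ⟩
    iter f a (r * p + (d + s))            ≡⟨ iter-cycle loop r d ⟩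
    iter f a (d + s)                      ∎
    where
    open ≡-Reasoning
    open +-*-Solver
    regroup : ∀ p q d s → (p + q) + (d + s) ≡ (q + d) + (p + s)
    regroup = solve 4 (λ p q d s → (p :+ q) :+ (d :+ s) := (q :+ d) :+ (p :+ s)) refl

  -- The period t ∸ s is at most K, hence divides K!.
  iter-repeat : ∀ {s t K} → s < t → t ≤ K → iter f a s ≡ iter f a t →
                ∀ q {c} → K ≤ c → iter f a (q * K ! + c) ≡ iter f a c
  iter-repeat {s} {t} {K} s<t t≤K eq q {c} K≤c
    with divides w K!≡w*p ← m∣n! (m<n⇒0<n∸m s<t) (≤-trans (m∸n≤m t s) t≤K) = begin
      iter f a (q * K ! + c)                  ≡⟨ cong (λ u → iter f a (q * u + c)) K!≡w*p ⟩
      iter f a (q * (w * p) + c)              ≡⟨ cong (λ u → iter f a (u + c)) (*-assoc q w p) ⟨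
      iter f a ((q * w) * p + c)              ≡⟨ cong (λ u → iter f a ((q * w) * p + u)) c≡ ⟨
      iter f a ((q * w) * p + ((c ∸ s) + s)) ≡⟨ iter-cycle loop (q * w) (c ∸ s) ⟩
      iter f a ((c ∸ s) + s)                  ≡⟨ cong (iter f a) c≡ ⟩
      iter f a c                              ∎
    where
    open ≡-Reasoning
    p = t ∸ s
    loop : iter f a (p + s) ≡ iter f a s
    loop = trans (cong (iter f a) (m∸n+n≡m (<⇒≤ s<t))) (sym eq)
    c≡ : (c ∸ s) + s ≡ c
    c≡ = m∸n+n≡m (≤-trans (<⇒≤ s<t) (≤-trans t≤K K≤c))

◂-injective : ∀ {A : Set} {d} {e : A} {h : Fin d → A} →
              (∀ i → h i ≢ e) → Injective _≡_ _≡_ h → Injective _≡_ _≡_ (e ◂ h)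
◂-injective fresh h-inj {zero}  {zero}  _  = refl
◂-injective fresh h-inj {zero}  {suc j} eq = contradiction (sym eq) (fresh j)
◂-injective fresh h-inj {suc i} {zero}  eq = contradiction eq (fresh i)
◂-injective fresh h-inj {suc i} {suc j} eq = cong suc (h-inj eq)

module Enumeration {A : Set} {K : ℕ} (enum : Fin K → A) (enum-onto : ∀ a → ∃ λ i → enum i ≡ a) where

  index : A → Fin K
  index a = proj₁ (enum-onto a)

  index-injective : Injective _≡_ _≡_ index
  index-injective {a} {b} eq =
    trans (sym (proj₂ (enum-onto a))) (trans (cong enum eq) (proj₂ (enum-onto b)))

  pigeonhole : (h : Fin (suc K) → A) → ∃₂ λ i j → i Fin.< j × h i ≡ h j
  pigeonhole h with i , j , i<j , eq ← Finₚ.pigeonhole (n<1+n K) (index ∘ h) =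
    i , j , i<j , index-injective eq

  no-injection : (h : Fin (suc K) → A) → ¬ Injective _≡_ _≡_ h
  no-injection h h-inj = 1+n≰n (injective⇒≤ (h-inj ∘ index-injective))

  iter-periodic : ∀ (f : A → A) a q {c} → K ≤ c → iter f a (q * K ! + c) ≡ iter f a c
  iter-periodic f a q K≤c with i , j , i<j , eq ← pigeonhole (iter f a ∘ toℕ) =
    iter-repeat f a i<j (≤-pred (toℕ<n j)) eq q K≤c

listed⇒finite : ∀ {A : Set} {P : A → Set} (xs : List A) →
                (_∈ₗ xs) Unary.⊆ P → P Unary.⊆ (_∈ₗ xs) →
                IsFinite {Σ A P} (λ a b → proj₁ a ≡ proj₁ b)
listed⇒finite xs sound complete =
  length xs , (λ i → lookup xs i , sound (∈-lookup i)) ,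
  λ (_ , px) → Any.index (complete px) , sym (lookup-index (complete px))

-- Iterating an inflationary monotone operator on collections of elements of a
-- K-element type reaches a closed stage within K steps, since every step that is
-- not closed adds a new element.
module Saturation {E S : Set} (_∈_ : E → S → Set) (_∈?_ : ∀ e s → Dec (e ∈ s))
  {K : ℕ} (enum : Fin K → E) (enum-onto : ∀ e → ∃ λ i → enum i ≡ e)
  (g : S → S)
  (g-inflationary : ∀ {s} → (_∈ s) Unary.⊆ (_∈ g s))
  (g-monotone : ∀ {s t} → (_∈ s) Unary.⊆ (_∈ t) → (_∈ g s) Unary.⊆ (_∈ g t)) where

  open Enumeration enum enum-onto using (no-injection)

  closed-or-new : ∀ s → (_∈ g s) Unary.⊆ (_∈ s) ⊎ ∃ λ e → e ∈ g s × ¬ e ∈ s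
  closed-or-new s with any? (λ i → (enum i ∈? g s) ×-dec ¬? (enum i ∈? s))
  ... | yes (i , new) = inj₂ (enum i , new)
  ... | no ¬new = inj₁ closed
    where
    closed : (_∈ g s) Unary.⊆ (_∈ s)
    closed {e} e∈gs with i , refl ← enum-onto e =
      decidable-stable (e ∈? s) (λ e∉s → ¬new (i , e∈gs , e∉s))

  module _ (s₀ : S) where

    Closed : ℕ → Set
    Closed d = (_∈ g (iter g s₀ d)) Unary.⊆ (_∈ iter g s₀ d)

    closed-or-growing : ∀ d → Closed d ⊎
      Σ (Fin (suc d) → E) λ h → Injective _≡_ _≡_ h × (∀ i → h i ∈ iter g s₀ (suc d))
    closed-or-growing zero with closed-or-new s₀
    ... | inj₁ closed       = inj₁ closed
    ... | inj₂ (e , e∈ , _) = inj₂ ((λ _ → e) , (λ { {zero} {zero} _ → refl }) , λ _ → e∈)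
    closed-or-growing (suc d) with closed-or-growing d
    ... | inj₁ closed = inj₁ (g-monotone closed)
    ... | inj₂ (h , h-inj , h∈) with closed-or-new (iter g s₀ (suc d))
    ...   | inj₁ closed       = inj₁ closed
    ...   | inj₂ (e , e∈ , e∉) =
      inj₂ (e ◂ h , ◂-injective (λ i hi≡e → e∉ (subst (_∈ _) hi≡e (h∈ i))) h-inj ,
            λ { zero → e∈ ; (suc i) → g-inflationary (h∈ i) })

    iter-closed : Closed K
    iter-closed with closed-or-growing K
    ... | inj₁ closed          = closed
    ... | inj₂ (h , h-inj , _) = ⊥-elim (no-injection h h-inj)

    iter-inflationary : ∀ k → (_∈ s₀) Unary.⊆ (_∈ iter g s₀ k)
    iter-inflationary zero    e∈ = e∈
    iter-inflationary (suc k) e∈ = g-inflationary (iter-inflationary k e∈)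

fromBit : Fin 2 → Bool
fromBit zero    = false
fromBit (suc _) = true

toBit : Bool → Fin 2
toBit false = zero
toBit true  = suc zero

fromBit-toBit : ∀ b → fromBit (toBit b) ≡ b
fromBit-toBit false = refl
fromBit-toBit true  = refl

-- A subset of Fin (suc n) is read off a Fin (2 * 2 ^ n) as its first bit and the rest.
decode : ∀ {n} → Fin (2 ^ n) → Subset n
decode {zero}  _ = []
decode {suc n} i = fromBit (proj₁ (remQuot {2} (2 ^ n) i)) ∷ decode (proj₂ (remQuot {2} (2 ^ n) i))

encode : ∀ {n} → Subset n → Fin (2 ^ n)
encode []      = zero
encode (b ∷ p) = combine (toBit b) (encode p)

decode-encode : ∀ {n} (p : Subset n) → decode (encode p) ≡ p
decode-encode []      = refl
decode-encode (b ∷ p) = cong₂ _∷_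
  (trans (cong (fromBit ∘ proj₁) split) (fromBit-toBit b))
  (trans (cong (decode ∘ proj₂) split) (decode-encode p))
  where split = remQuot-combine (toBit b) (encode p)

decode-surjective : ∀ {n} (p : Subset n) → ∃ λ i → decode i ≡ p
decode-surjective p = encode p , decode-encode p

subset-finite : ∀ {n} → IsFinite {Subset n} _≡_
subset-finite = _ , decode , decode-surjective

module _ {n : ℕ} {P : Fin n → Set} (P? : ∀ z → Dec (P z)) where

  ∈-tabulate⁺ : ∀ {z} → P z → z ∈ tabulate (λ z → does (P? z))
  ∈-tabulate⁺ {z} pz = lookup⇒[]= z _ (trans (lookup∘tabulate _ z) (dec-true (P? z) pz))

  ∈-tabulate⁻ : ∀ {z} → z ∈ tabulate (λ z → does (P? z)) → P z
  ∈-tabulate⁻ {z} z∈ =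
    invert (subst (Reflects (P z)) (trans (sym (lookup∘tabulate _ z)) ([]=⇒lookup z∈)) (proof (P? z)))

∈-⋃⁺ : ∀ {n} {Ys : List (Subset n)} {Y z} → Y ∈ₗ Ys → z ∈ Y → z ∈ ⋃ Ys
∈-⋃⁺ {Ys = Y ∷ Ys} (here refl) z∈Y = x∈p∪q⁺ (inj₁ z∈Y)
∈-⋃⁺ {Ys = Y ∷ Ys} (there Y∈) z∈Y = x∈p∪q⁺ (inj₂ (∈-⋃⁺ Y∈ z∈Y))

∈-⋃⁻ : ∀ {n} (Ys : List (Subset n)) {z} → z ∈ ⋃ Ys → ∃ λ Y → Y ∈ₗ Ys × z ∈ Y
∈-⋃⁻ []       z∈ = ⊥-elim (∉⊥ z∈)
∈-⋃⁻ (Y ∷ Ys) z∈ with x∈p∪q⁻ Y (⋃ Ys) z∈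
... | inj₁ z∈Y  = Y , here refl , z∈Y
... | inj₂ z∈Ys with Y′ , Y′∈ , z∈Y′ ← ∈-⋃⁻ Ys z∈Ys = Y′ , there Y′∈ , z∈Y′

module MonoidPowers {A : Set} {_∙_ : Op₂ A} {ε : A} (isMonoid : IsMonoid _≡_ _∙_ ε) where
  open IsMonoid isMonoid using (assoc; identityˡ; identityʳ)
  open ≡-Reasoning

  power : A → ℕ → A
  power = pow ε _∙_

  pow-+ : ∀ x m n → power x (m + n) ≡ power x m ∙ power x n
  pow-+ x zero    n = sym (identityˡ _)
  pow-+ x (suc m) n = trans (cong (x ∙_) (pow-+ x m n)) (sym (assoc _ _ _))

  pow-sucʳ : ∀ x n → power x (suc n) ≡ power x n ∙ x
  pow-sucʳ x n = begin
    power x (suc n)      ≡⟨ cong (power x) (+-comm 1 n) ⟩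
    power x (n + 1)      ≡⟨ pow-+ x n 1 ⟩
    power x n ∙ (x ∙ ε)  ≡⟨ cong (power x n ∙_) (identityʳ x) ⟩
    power x n ∙ x        ∎

  pow-* : ∀ x m n → power (power x m) n ≡ power x (m * n)
  pow-* x m zero    = cong (power x) (sym (*-zeroʳ m))
  pow-* x m (suc n) = begin
    power x m ∙ power (power x m) n ≡⟨ cong (power x m ∙_) (pow-* x m n) ⟩
    power x m ∙ power x (m * n)     ≡⟨ pow-+ x m (m * n) ⟨
    power x (m + m * n)             ≡⟨ cong (power x) (*-suc m n) ⟨
    power x (m * suc n)             ∎

  pow-pow-comm : ∀ x m n → power (power x m) n ≡ power (power x n) m
  pow-pow-comm x m n = begin
    power (power x m) n ≡⟨ pow-* x m n ⟩
    power x (m * n)     ≡⟨ cong (power x) (*-comm m n) ⟩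
    power x (n * m)     ≡⟨ pow-* x n m ⟨
    power (power x n) m ∎

  pow-slide : ∀ x y n → power (x ∙ y) n ∙ x ≡ x ∙ power (y ∙ x) n
  pow-slide x y zero    = trans (identityˡ x) (sym (identityʳ x))
  pow-slide x y (suc n) = begin
    ((x ∙ y) ∙ power (x ∙ y) n) ∙ x ≡⟨ assoc _ _ _ ⟩
    (x ∙ y) ∙ (power (x ∙ y) n ∙ x) ≡⟨ cong ((x ∙ y) ∙_) (pow-slide x y n) ⟩
    (x ∙ y) ∙ (x ∙ power (y ∙ x) n) ≡⟨ assoc _ _ _ ⟩
    x ∙ (y ∙ (x ∙ power (y ∙ x) n)) ≡⟨ cong (x ∙_) (assoc _ _ _) ⟨
    x ∙ ((y ∙ x) ∙ power (y ∙ x) n) ∎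

  pow-swap : ∀ x y n → power (x ∙ y) (suc n) ≡ x ∙ (power (y ∙ x) n ∙ y)
  pow-swap x y n = begin
    (x ∙ y) ∙ power (x ∙ y) n ≡⟨ assoc _ _ _ ⟩
    x ∙ (y ∙ power (x ∙ y) n) ≡⟨ cong (x ∙_) (pow-slide y x n) ⟨
    x ∙ (power (y ∙ x) n ∙ y) ∎

  pow-idempotent : ∀ {x} → x ∙ x ≡ x → ∀ {n} → 0 < n → power x n ≡ x
  pow-idempotent {x} xx {suc zero}    _ = identityʳ x
  pow-idempotent {x} xx {suc (suc n)} _ = trans (cong (x ∙_) (pow-idempotent xx {suc n} z<s)) xx

  pow≡iter : ∀ x n → power x n ≡ iter (x ∙_) ε n
  pow≡iter x zero    = refl
  pow≡iter x (suc n) = cong (x ∙_) (pow≡iter x n)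

module PowerProperties {n : ℕ} (M : FiniteOrdinalMonoid n) where
  open ≡-Reasoning
  open FiniteOrdinalMonoid M
  open IsFiniteOrdinalMonoid isFiniteOrdinalMonoid using (assoc; identityˡ; identityʳ; ω-swap; ω-pow; ω-one)
  open Power M

  -- Witnesses are destructured with case rather than with: with-abstraction over
  -- goals mentioning the tabulated sets ·P, ωP, mergeP is very slow to check.

  ω-rotate : ∀ u a b → u ∙ ω (a ∙ b) ≡ (u ∙ a) ∙ ω (b ∙ a)
  ω-rotate u a b = trans (cong (u ∙_) (ω-swap a b)) (sym (assoc u a _))

  ·P-witness : Subset n → Subset n → Fin n → Set
  ·P-witness X Y z = ∃₂ λ x y → x ∈ X × y ∈ Y × x ∙ y ≡ z

  ·P-witness? : ∀ X Y z → Dec (·P-witness X Y z)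
  ·P-witness? X Y z = any? λ x → any? λ y → (x ∈? X) ×-dec ((y ∈? Y) ×-dec ((x ∙ y) Fin.≟ z))

  ∈-·⁺ : ∀ {X Y x y} → x ∈ X → y ∈ Y → x ∙ y ∈ X ·P Y
  ∈-·⁺ {X} {Y} x∈ y∈ = ∈-tabulate⁺ (·P-witness? X Y) (_ , _ , x∈ , y∈ , refl)

  ∈-·⁻ : ∀ {X Y z} → z ∈ X ·P Y → ·P-witness X Y z
  ∈-·⁻ {X} {Y} = ∈-tabulate⁻ (·P-witness? X Y)

  ·P-mono : ∀ {X X′ Y Y′} → X ⊆ X′ → Y ⊆ Y′ → X ·P Y ⊆ X′ ·P Y′
  ·P-mono X⊆ Y⊆ z∈ = case ∈-·⁻ z∈ of λ where
    (x , y , x∈ , y∈ , refl) → ∈-·⁺ (X⊆ x∈) (Y⊆ y∈)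

  ·P-assoc : ∀ X Y Z → (X ·P Y) ·P Z ≡ X ·P (Y ·P Z)
  ·P-assoc X Y Z = ⊆-antisym lhs⊆rhs rhs⊆lhs
    where
    lhs⊆rhs : (X ·P Y) ·P Z ⊆ X ·P (Y ·P Z)
    lhs⊆rhs z∈ = case ∈-·⁻ {X ·P Y} z∈ of λ where
      (w , c , w∈ , c∈ , refl) → case ∈-·⁻ {X} {Y} w∈ of λ where
        (a , b , a∈ , b∈ , refl) →
          subst (_∈ X ·P (Y ·P Z)) (sym (assoc a b c)) (∈-·⁺ a∈ (∈-·⁺ b∈ c∈))
    rhs⊆lhs : X ·P (Y ·P Z) ⊆ (X ·P Y) ·P Z
    rhs⊆lhs z∈ = case ∈-·⁻ {X} z∈ of λ where
      (a , w , a∈ , w∈ , refl) → case ∈-·⁻ {Y} {Z} w∈ of λ where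
        (b , c , b∈ , c∈ , refl) →
          subst (_∈ (X ·P Y) ·P Z) (assoc a b c) (∈-·⁺ (∈-·⁺ a∈ b∈) c∈)

  ∈-oneP : ∀ {z} → z ∈ oneP → z ≡ one
  ∈-oneP = x∈⁅y⁆⇒x≡y one

  ·P-identityˡ : ∀ X → oneP ·P X ≡ X
  ·P-identityˡ X = ⊆-antisym lhs⊆rhs rhs⊆lhs
    where
    lhs⊆rhs : oneP ·P X ⊆ X
    lhs⊆rhs z∈ = case ∈-·⁻ {oneP} z∈ of λ where
      (a , b , a∈ , b∈ , refl) →
        subst (_∈ X) (trans (sym (identityˡ b)) (cong (_∙ b) (sym (∈-oneP a∈)))) b∈
    rhs⊆lhs : X ⊆ oneP ·P X
    rhs⊆lhs {z} z∈ = subst (_∈ oneP ·P X) (identityˡ z) (∈-·⁺ (x∈⁅x⁆ one) z∈)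

  ·P-identityʳ : ∀ X → X ·P oneP ≡ X
  ·P-identityʳ X = ⊆-antisym lhs⊆rhs rhs⊆lhs
    where
    lhs⊆rhs : X ·P oneP ⊆ X
    lhs⊆rhs z∈ = case ∈-·⁻ {X} {oneP} z∈ of λ where
      (a , b , a∈ , b∈ , refl) →
        subst (_∈ X) (trans (sym (identityʳ a)) (cong (a ∙_) (sym (∈-oneP b∈)))) a∈
    rhs⊆lhs : X ⊆ X ·P oneP
    rhs⊆lhs {z} z∈ = subst (_∈ X ·P oneP) (identityʳ z) (∈-·⁺ z∈ (x∈⁅x⁆ one))

  ·P-isMonoid : IsMonoid _≡_ _·P_ oneP
  ·P-isMonoid = record
    { isSemigroup = record
      { isMagma = record { isEquivalence = isEquivalence ; ∙-cong = cong₂ _·P_ }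
      ; assoc   = ·P-assoc
      }
    ; identity = ·P-identityˡ , ·P-identityʳ
    }

  open MonoidPowers ·P-isMonoid

  pow-∈ : ∀ {X x} → x ∈ X → ∀ e → pow one _∙_ x e ∈ powP X e
  pow-∈ x∈ zero    = x∈⁅x⁆ one
  pow-∈ x∈ (suc e) = ∈-·⁺ x∈ (pow-∈ x∈ e)

  pow-mono : ∀ {X Y} → X ⊆ Y → ∀ e → powP X e ⊆ powP Y e
  pow-mono X⊆Y zero    = id
  pow-mono X⊆Y (suc e) = ·P-mono X⊆Y (pow-mono X⊆Y e)

  pow-sucʳ-split : ∀ X Y j → (powP (X ·P Y) j ·P X) ·P Y ≡ powP (X ·P Y) (suc j)
  pow-sucʳ-split X Y j = trans (·P-assoc (powP (X ·P Y) j) X Y) (sym (pow-sucʳ (X ·P Y) j))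

  _∈⁺_ : Fin n → Subset n → Set
  x ∈⁺ X = ∃ λ k → x ∈ powP X (suc k)

  module _ (X : Subset n) where

    private
      grow : Subset n → Subset n
      grow Y = Y ∪ (Y ·P X)

      grow-mono : ∀ {Y Y′} → Y ⊆ Y′ → grow Y ⊆ grow Y′
      grow-mono Y⊆ z∈ with x∈p∪q⁻ _ _ z∈
      ... | inj₁ z∈Y  = x∈p∪q⁺ (inj₁ (Y⊆ z∈Y))
      ... | inj₂ z∈YX = x∈p∪q⁺ (inj₂ (·P-mono Y⊆ id z∈YX))

    open Saturation _∈_ _∈?_ id (λ i → i , refl) grow (λ z∈ → x∈p∪q⁺ (inj₁ z∈)) grow-mono

    iter-grow⊆⁺ : ∀ k {z} → z ∈ iter grow X k → z ∈⁺ X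
    iter-grow⊆⁺ zero    z∈ = 0 , ⊆-reflexive (sym (·P-identityʳ X)) z∈
    iter-grow⊆⁺ (suc k) z∈ with x∈p∪q⁻ _ _ z∈
    ... | inj₁ z∈Y  = iter-grow⊆⁺ k z∈Y
    ... | inj₂ z∈YX = case ∈-·⁻ {iter grow X k} {X} z∈YX of λ where
      (y , x , y∈ , x∈ , refl) → case iter-grow⊆⁺ k y∈ of λ where
        (e , y∈ₑ) → suc e , ⊆-reflexive (sym (pow-sucʳ X (suc e))) (∈-·⁺ y∈ₑ x∈)

    ∈-plus⁻ : ∀ {z} → z ∈ plusP X → z ∈⁺ X
    ∈-plus⁻ = iter-grow⊆⁺ n

    -- plusP X is the n-th stage of the chain, which is closed under grow.
    pow⊆plus : ∀ e → powP X (suc e) ⊆ plusP X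
    pow⊆plus zero    z∈ = iter-inflationary X n (⊆-reflexive (·P-identityʳ X) z∈)
    pow⊆plus (suc e) z∈ = case ∈-·⁻ {powP X (suc e)} (⊆-reflexive (pow-sucʳ X (suc e)) z∈) of λ where
      (y , x , y∈ , x∈ , refl) → iter-closed X (x∈p∪q⁺ (inj₂ (∈-·⁺ (pow⊆plus e y∈) x∈)))

  ωP-witness : Subset n → Fin n → Set
  ωP-witness X z = ∃₂ λ u v → u ∈ plusP X × v ∈ plusP X × u ∙ ω v ≡ z

  ωP-witness? : ∀ X z → Dec (ωP-witness X z)
  ωP-witness? X z = any? λ u → any? λ v →
    (u ∈? plusP X) ×-dec ((v ∈? plusP X) ×-dec ((u ∙ ω v) Fin.≟ z))

  ∈-ω⁺ : ∀ {X u v} → u ∈⁺ X → v ∈⁺ X → u ∙ ω v ∈ ωP X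
  ∈-ω⁺ {X} (i , u∈) (j , v∈) =
    ∈-tabulate⁺ (ωP-witness? X) (_ , _ , pow⊆plus X i u∈ , pow⊆plus X j v∈ , refl)

  ∈-ω⁻ : ∀ {X z} → z ∈ ωP X → ∃₂ λ u v → u ∈⁺ X × v ∈⁺ X × u ∙ ω v ≡ z
  ∈-ω⁻ {X} z∈ = case ∈-tabulate⁻ (ωP-witness? X) z∈ of λ where
    (u , v , u∈ , v∈ , eq) → u , v , ∈-plus⁻ X u∈ , ∈-plus⁻ X v∈ , eq

  ωP-mono : ∀ {X Y} → X ⊆ Y → ωP X ⊆ ωP Y
  ωP-mono X⊆Y z∈ = case ∈-ω⁻ z∈ of λ where
    (u , v , (i , u∈) , (j , v∈) , refl) →
      ∈-ω⁺ (i , pow-mono X⊆Y (suc i) u∈) (j , pow-mono X⊆Y (suc j) v∈)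

  ∈⁺-oneP : ∀ {u} → u ∈⁺ oneP → u ≡ one
  ∈⁺-oneP (k , u∈) = ∈-oneP (⊆-reflexive (pow-idempotent (·P-identityˡ oneP) {suc k} z<s) u∈)

  ωP-one : ωP oneP ≡ oneP
  ωP-one = ⊆-antisym lhs⊆rhs rhs⊆lhs
    where
    one∙ωone : one ∙ ω one ≡ one
    one∙ωone = trans (identityˡ (ω one)) ω-one
    lhs⊆rhs : ωP oneP ⊆ oneP
    lhs⊆rhs z∈ = case ∈-ω⁻ z∈ of λ where
      (u , v , u∈ , v∈ , refl) →
        subst (_∈ oneP) (sym (trans (cong₂ (λ a b → a ∙ ω b) (∈⁺-oneP u∈) (∈⁺-oneP v∈)) one∙ωone)) (x∈⁅x⁆ one)
    one∈⁺ : one ∈⁺ oneP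
    one∈⁺ = 0 , ⊆-reflexive (sym (·P-identityˡ oneP)) (x∈⁅x⁆ one)
    rhs⊆lhs : oneP ⊆ ωP oneP
    rhs⊆lhs z∈ = subst (_∈ ωP oneP) (trans one∙ωone (sym (∈-oneP z∈))) (∈-ω⁺ one∈⁺ one∈⁺)

  ω-rotate-∈ : ∀ {U A B u v} → u ∈ U → v ∈ A ·P B →
               ∃₂ λ u′ v′ → u′ ∈ U ·P A × v′ ∈ B ·P A × u′ ∙ ω v′ ≡ u ∙ ω v
  ω-rotate-∈ {U} {A} {B} {u} u∈ v∈ = case ∈-·⁻ {A} {B} v∈ of λ where
    (a , b , a∈ , b∈ , refl) → u ∙ a , b ∙ a , ∈-·⁺ u∈ a∈ , ∈-·⁺ b∈ a∈ , sym (ω-rotate u a b)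

  ωP-swap : ∀ X Y → ωP (X ·P Y) ≡ X ·P ωP (Y ·P X)
  ωP-swap X Y = ⊆-antisym lhs⊆rhs rhs⊆lhs
    where
    lhs⊆rhs : ωP (X ·P Y) ⊆ X ·P ωP (Y ·P X)
    lhs⊆rhs z∈ = case ∈-ω⁻ z∈ of λ where
      (u , v , (i , u∈) , (j , v∈) , refl) →
        case ω-rotate-∈ {B = powP (Y ·P X) j ·P Y} u∈ (⊆-reflexive (pow-swap X Y j) v∈) of λ where
          (u′ , v′ , u′∈ , v′∈ , eq) →
            case ∈-·⁻ {X} {powP (Y ·P X) (suc i)} (⊆-reflexive (pow-slide X Y (suc i)) u′∈) of λ where
              (x , w , x∈ , w∈ , refl) →
                subst (_∈ X ·P ωP (Y ·P X)) (trans (sym (assoc x w (ω v′))) eq)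
                  (∈-·⁺ x∈ (∈-ω⁺ (i , w∈) (j , ⊆-reflexive (pow-sucʳ-split Y X j) v′∈)))
    rhs⊆lhs : X ·P ωP (Y ·P X) ⊆ ωP (X ·P Y)
    rhs⊆lhs z∈ = case ∈-·⁻ {X} {ωP (Y ·P X)} z∈ of λ where
      (x , t , x∈ , t∈ , refl) → case ∈-ω⁻ t∈ of λ where
        (u , v , (i , u∈) , (j , v∈) , refl) →
          case ω-rotate-∈ {B = powP (X ·P Y) j ·P X} u∈ (⊆-reflexive (pow-swap Y X j) v∈) of λ where
            (u′ , v′ , u′∈ , v′∈ , eq) →
              subst (_∈ ωP (X ·P Y)) (trans (assoc x u′ (ω v′)) (cong (x ∙_) eq))
                (∈-ω⁺ (suc i , ⊆-reflexive (sym (pow-swap X Y (suc i))) (∈-·⁺ x∈ u′∈))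
                      (j , ⊆-reflexive (pow-sucʳ-split X Y j) v′∈))

  ω-rotate-pow : ∀ {X u v} i j d → u ∈ powP X i → v ∈ powP X (suc j) →
                 ∃₂ λ u′ v′ → u′ ∈ powP X (i + d) × v′ ∈ powP X (suc j) × u′ ∙ ω v′ ≡ u ∙ ω v
  ω-rotate-pow {X} {u} {v} i j zero u∈ v∈ =
    u , v , subst (λ k → u ∈ powP X k) (sym (+-identityʳ i)) u∈ , v∈ , refl
  ω-rotate-pow {X} i j (suc d) u∈ v∈ = case ω-rotate-∈ {B = powP X j} u∈ v∈ of λ where
    (u₁ , v₁ , u₁∈ , v₁∈ , eq₁) →
      case ω-rotate-pow (suc i) j d (⊆-reflexive (sym (pow-sucʳ X i)) u₁∈)
                                    (⊆-reflexive (sym (pow-sucʳ X j)) v₁∈) of λ where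
        (u′ , v′ , u′∈ , v′∈ , eq) →
          u′ , v′ , subst (λ k → u′ ∈ powP X k) (sym (+-suc i d)) u′∈ , v′∈ , trans eq eq₁

  ωP-pow : ∀ X k → ωP (powP X (suc k)) ≡ ωP X
  ωP-pow X k = ⊆-antisym lhs⊆rhs rhs⊆lhs
    where
    K = suc k
    lhs⊆rhs : ωP (powP X K) ⊆ ωP X
    lhs⊆rhs z∈ = case ∈-ω⁻ z∈ of λ where
      (u , v , (i , u∈) , (j , v∈) , refl) →
        ∈-ω⁺ (i + k * suc i , ⊆-reflexive (pow-* X K (suc i)) u∈)
             (j + k * suc j , ⊆-reflexive (pow-* X K (suc j)) v∈)
    -- Rotate u ∙ ω v until the prefix has length K * (i + 1), then use v^ω = (v^K)^ω.
    rhs⊆lhs : ωP X ⊆ ωP (powP X K)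
    rhs⊆lhs z∈ = case ∈-ω⁻ z∈ of λ where
      (u , v , (i , u∈) , (j , v∈) , refl) → case ω-rotate-pow (suc i) j (k * suc i) u∈ v∈ of λ where
        (u′ , v′ , u′∈ , v′∈ , eq) →
          subst (_∈ ωP (powP X K)) (trans (cong (u′ ∙_) (ω-pow v′ k)) eq)
            (∈-ω⁺ (i , ⊆-reflexive (sym (pow-* X K (suc i))) u′∈)
                  (j , ⊆-reflexive (pow-pow-comm X (suc j) K) (pow-∈ v′∈ K)))

  F : ℕ
  F = N !

  instance
    F-nonZero : NonZero F
    F-nonZero = N !≢0

  N≤F : N ≤ F
  N≤F = n≤n! N

  open Enumeration (decode {n}) decode-surjective using (iter-periodic)

  powP-periodic : ∀ X q {c} → N ≤ c → powP X (q * F + c) ≡ powP X c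
  powP-periodic X q {c} N≤c = begin
    powP X (q * F + c)            ≡⟨ pow≡iter X (q * F + c) ⟩
    iter (X ·P_) oneP (q * F + c) ≡⟨ iter-periodic (X ·P_) oneP q N≤c ⟩
    iter (X ·P_) oneP c           ≡⟨ pow≡iter X c ⟨
    powP X c                      ∎

  powP-+F : ∀ X {c} → N ≤ c → powP X (F + c) ≡ powP X c
  powP-+F X {c} N≤c = trans (cong (λ t → powP X (t + c)) (sym (+-identityʳ F))) (powP-periodic X 1 N≤c)

  ∈-merge⁻ : ∀ {X z} → z ∈ mergeP X → ∃ λ e → F ≤ e × z ∈ powP X e
  ∈-merge⁻ {X} z∈ = case ∈-⋃⁻ (map (λ k → powP X (F + k)) (upTo F)) z∈ of λ where
    (Y , Y∈ , z∈Y) → case ∈-map⁻ (λ k → powP X (F + k)) Y∈ of λ where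
      (k , _ , refl) → F + k , m≤m+n F k , z∈Y

  ∈-merge⁺ : ∀ {X z e} → F ≤ e → z ∈ powP X e → z ∈ mergeP X
  ∈-merge⁺ {X} {z} {e} F≤e z∈ =
    ∈-⋃⁺ (∈-map⁺ (λ k → powP X (F + k)) (∈-upTo⁺ (m%n<n d F))) (⊆-reflexive reduce z∈)
    where
    d = e ∸ F
    e≡ : e ≡ (d / F) * F + (F + d % F)
    e≡ = begin
      e                          ≡⟨ m∸n+n≡m F≤e ⟨
      d + F                      ≡⟨ cong (_+ F) (m≡m%n+[m/n]*n d F) ⟩
      (d % F + (d / F) * F) + F  ≡⟨ regroup (d % F) ((d / F) * F) F ⟩
      (d / F) * F + (F + d % F)  ∎
      where
      open +-*-Solver
      regroup : ∀ r q f → (r + q) + f ≡ q + (f + r)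
      regroup = solve 3 (λ r q f → (r :+ q) :+ f := q :+ (f :+ r)) refl
    reduce : powP X e ≡ powP X (F + d % F)
    reduce = trans (cong (powP X) e≡) (powP-periodic X (d / F) (≤-trans N≤F (m≤m+n F _)))

  mergeP-mono : ∀ {X Y} → X ⊆ Y → mergeP X ⊆ mergeP Y
  mergeP-mono X⊆Y z∈ = case ∈-merge⁻ z∈ of λ where
    (e , F≤e , z∈ₑ) → ∈-merge⁺ F≤e (pow-mono X⊆Y e z∈ₑ)

  mergeP-∙-mergeP : ∀ X → mergeP X ·P mergeP X ≡ mergeP X
  mergeP-∙-mergeP X = ⊆-antisym lhs⊆rhs rhs⊆lhs
    where
    lhs⊆rhs : mergeP X ·P mergeP X ⊆ mergeP X
    lhs⊆rhs z∈ = case ∈-·⁻ {mergeP X} {mergeP X} z∈ of λ where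
      (s , t , s∈ , t∈ , refl) → case ∈-merge⁻ s∈ , ∈-merge⁻ t∈ of λ where
        ((e , F≤e , s∈ₑ) , (e′ , _ , t∈ₑ′)) →
          ∈-merge⁺ (≤-trans F≤e (m≤m+n e e′)) (⊆-reflexive (sym (pow-+ X e e′)) (∈-·⁺ s∈ₑ t∈ₑ′))
    rhs⊆lhs : mergeP X ⊆ mergeP X ·P mergeP X
    rhs⊆lhs z∈ = case ∈-merge⁻ z∈ of λ where
      (e , F≤e , z∈ₑ) → ·P-mono (∈-merge⁺ ≤-refl) (∈-merge⁺ F≤e)
        (⊆-reflexive (trans (sym (powP-+F X (≤-trans N≤F F≤e))) (pow-+ X F e)) z∈ₑ)

  idempotent⇒mergeP≡ : ∀ {E} → E ·P E ≡ E → mergeP E ≡ E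
  idempotent⇒mergeP≡ {E} EE≡E = ⊆-antisym lhs⊆rhs rhs⊆lhs
    where
    lhs⊆rhs : mergeP E ⊆ E
    lhs⊆rhs z∈ = case ∈-merge⁻ z∈ of λ where
      (e , F≤e , z∈ₑ) → ⊆-reflexive (pow-idempotent EE≡E (≤-trans (>-nonZero⁻¹ F) F≤e)) z∈ₑ
    rhs⊆lhs : E ⊆ mergeP E
    rhs⊆lhs z∈ = ∈-merge⁺ ≤-refl (⊆-reflexive (sym (pow-idempotent EE≡E (>-nonZero⁻¹ F))) z∈)

  mergeP-mergeP : ∀ X → mergeP (mergeP X) ≡ mergeP X
  mergeP-mergeP X = idempotent⇒mergeP≡ (mergeP-∙-mergeP X)

  mergeP-shift : ∀ A B → mergeP (A ·P B) ≡ A ·P (mergeP (B ·P A) ·P B)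
  mergeP-shift A B = ⊆-antisym lhs⊆rhs rhs⊆lhs
    where
    powP-shift : ∀ e → F ≤ e → powP (A ·P B) e ⊆ A ·P (mergeP (B ·P A) ·P B)
    powP-shift zero    F≤0 = ⊥-elim (1+n≰n (≤-trans (>-nonZero⁻¹ F) F≤0))
    powP-shift (suc m) F≤e =
      ·P-mono id (·P-mono (∈-merge⁺ (m≤m+n F m)) id) ∘ ⊆-reflexive (begin
        powP (A ·P B) (suc m)              ≡⟨ powP-+F (A ·P B) (≤-trans N≤F F≤e) ⟨
        powP (A ·P B) (F + suc m)          ≡⟨ cong (powP (A ·P B)) (+-suc F m) ⟩
        powP (A ·P B) (suc (F + m))        ≡⟨ pow-swap A B (F + m) ⟩
        A ·P (powP (B ·P A) (F + m) ·P B)  ∎)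
    lhs⊆rhs : mergeP (A ·P B) ⊆ A ·P (mergeP (B ·P A) ·P B)
    lhs⊆rhs z∈ = case ∈-merge⁻ z∈ of λ where
      (e , F≤e , z∈ₑ) → powP-shift e F≤e z∈ₑ
    rhs⊆lhs : A ·P (mergeP (B ·P A) ·P B) ⊆ mergeP (A ·P B)
    rhs⊆lhs z∈ = case ∈-·⁻ {A} {mergeP (B ·P A) ·P B} z∈ of λ where
      (a , w , a∈ , w∈ , refl) → case ∈-·⁻ {mergeP (B ·P A)} {B} w∈ of λ where
        (v , b , v∈ , b∈ , refl) → case ∈-merge⁻ v∈ of λ where
          (e , F≤e , v∈ₑ) → ∈-merge⁺ (≤-trans F≤e (n≤1+n e))
            (⊆-reflexive (sym (pow-swap A B e)) (∈-·⁺ a∈ (∈-·⁺ v∈ₑ b∈)))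

  idemPlus⊆mergeP : ∀ X k Y → IsIdemPlus _≡_ oneP _·P_ X k Y → Y ⊆ mergeP X
  idemPlus⊆mergeP X k Y (m₀ , Xᵉ≡Y) = case factorial-offset k m₀ F of λ where
    (m , e , m₀≤m , F≤e , e≡) → ∈-merge⁺ F≤e ∘ ⊆-reflexive (sym (Xᵉ≡Y m m₀≤m e e≡))

  idem-idempotent : ∀ X E → IsIdemPlus _≡_ oneP _·P_ X (+ 0) E → E ·P E ≡ E
  idem-idempotent X E (m₀ , Xᵉ≡E) = case m≤n⇒m!∣n! (m≤n+m N m₀) of λ where
      (divides q m!≡qF) → begin
        E ·P E                        ≡⟨ cong₂ _·P_ Xᵐ!≡E Xᵐ!≡E ⟨
        powP X (m !) ·P powP X (m !)  ≡⟨ pow-+ X (m !) (m !) ⟨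
        powP X (m ! + m !)            ≡⟨ cong (λ t → powP X (t + m !)) m!≡qF ⟩
        powP X (q * F + m !)          ≡⟨ powP-periodic X q (≤-trans (m≤n+m N m₀) (n≤n! m)) ⟩
        powP X (m !)                  ≡⟨ Xᵐ!≡E ⟩
        E                             ∎
    where
    m = m₀ + N
    Xᵐ!≡E : powP X (m !) ≡ E
    Xᵐ!≡E = Xᵉ≡E m (m≤m+n m₀ N) (m !) (cong +_ (sym (+-identityʳ (m !))))

  isFiniteOrdinalMonoidWithMerge : IsFiniteOrdinalMonoidWithMerge _≡_ _⊆_ oneP _·P_ ωP mergeP
  isFiniteOrdinalMonoidWithMerge = record
    { isFiniteOrdinalMonoid = record
      { isEquivalence = isEquivalence
      ; ∙-cong        = cong₂ _·P_
      ; ω-cong        = cong ωP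
      ; finite        = subset-finite
      ; assoc         = ·P-assoc
      ; identityˡ     = ·P-identityˡ
      ; identityʳ     = ·P-identityʳ
      ; ω-swap        = ωP-swap
      ; ω-pow         = ωP-pow
      ; ω-one         = ωP-one
      }
    ; isPartialOrder = ⊆-isPartialOrder n
    ; ∙-mono         = ·P-mono
    ; ω-mono         = ωP-mono
    ; merge-cong     = cong mergeP
    ; merge-mono     = mergeP-mono
    ; idemPlus≤merge = idemPlus⊆mergeP
    ; merge-idem     = λ X E idem → idempotent⇒mergeP≡ (idem-idempotent X E idem)
    ; merge-∙-merge  = mergeP-∙-mergeP
    ; merge-merge    = mergeP-mergeP
    ; merge-shift    = mergeP-shift
    }

module SatProperties {n : ℕ} (M : FiniteOrdinalMonoid n) {m : ℕ} (μ : Fin m → Fin n) where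
  open Power M
  open SatStr μ
  open PowerProperties M hiding (isFiniteOrdinalMonoidWithMerge)

  generators : List (Subset n)
  generators = oneP ∷ map (λ a → ⁅ μ a ⁆) (allFin m)

  step : List (Subset n) → List (Subset n)
  step Xs = Xs ++ cartesianProductWith _·P_ Xs Xs ++ map ωP Xs ++ map mergeP Xs

  step-monotone : ∀ {Xs Ys} → Xs ⊆ₗ Ys → step Xs ⊆ₗ step Ys
  step-monotone {Xs} {Ys} Xs⊆Ys =
    ++⁺ Xs⊆Ys (++⁺ products⊆ (++⁺ (map⁺ ωP Xs⊆Ys) (map⁺ mergeP Xs⊆Ys)))
    where
    products⊆ : cartesianProductWith _·P_ Xs Xs ⊆ₗ cartesianProductWith _·P_ Ys Ys
    products⊆ Z∈ with X , Y , X∈ , Y∈ , refl ← ∈-cartesianProductWith⁻ _·P_ Xs Xs Z∈ =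
      ∈-cartesianProductWith⁺ _·P_ (Xs⊆Ys X∈) (Xs⊆Ys Y∈)

  ∈-step-· : ∀ {Xs X Y} → X ∈ₗ Xs → Y ∈ₗ Xs → X ·P Y ∈ₗ step Xs
  ∈-step-· {Xs} X∈ Y∈ = ∈-++⁺ʳ Xs (∈-++⁺ˡ (∈-cartesianProductWith⁺ _·P_ X∈ Y∈))

  ∈-step-ω : ∀ {Xs X} → X ∈ₗ Xs → ωP X ∈ₗ step Xs
  ∈-step-ω {Xs} X∈ = ∈-++⁺ʳ Xs (∈-++⁺ʳ (cartesianProductWith _·P_ Xs Xs) (∈-++⁺ˡ (∈-map⁺ ωP X∈)))

  ∈-step-merge : ∀ {Xs X} → X ∈ₗ Xs → mergeP X ∈ₗ step Xs
  ∈-step-merge {Xs} X∈ =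
    ∈-++⁺ʳ Xs (∈-++⁺ʳ (cartesianProductWith _·P_ Xs Xs) (∈-++⁺ʳ (map ωP Xs) (∈-map⁺ mergeP X∈)))

  step-sound : ∀ {Xs} → (_∈ₗ Xs) Unary.⊆ InSat μ → (_∈ₗ step Xs) Unary.⊆ InSat μ
  step-sound {Xs} sat X∈ with ∈-++⁻ Xs X∈
  ... | inj₁ X∈Xs = sat X∈Xs
  ... | inj₂ X∈′ with ∈-++⁻ (cartesianProductWith _·P_ Xs Xs) X∈′
  ...   | inj₁ X∈× with _ , _ , Y∈ , Z∈ , refl ← ∈-cartesianProductWith⁻ _·P_ Xs Xs X∈× =
    sat-· (sat Y∈) (sat Z∈)
  ...   | inj₂ X∈″ with ∈-++⁻ (map ωP Xs) X∈″
  ...     | inj₁ X∈ω with _ , Y∈ , refl ← ∈-map⁻ ωP X∈ω = sat-ω (sat Y∈)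
  ...     | inj₂ X∈m with _ , Y∈ , refl ← ∈-map⁻ mergeP X∈m = sat-merge (sat Y∈)

  generators-sound : (_∈ₗ generators) Unary.⊆ InSat μ
  generators-sound (here refl) = sat-one
  generators-sound (there X∈) with a , _ , refl ← ∈-map⁻ (λ a → ⁅ μ a ⁆) X∈ = sat-μ a

  iter-step-sound : ∀ k → (_∈ₗ iter step generators k) Unary.⊆ InSat μ
  iter-step-sound zero    = generators-sound
  iter-step-sound (suc k) = step-sound (iter-step-sound k)

  open DecMembership (≡-dec {n = n} Bool._≟_) using () renaming (_∈?_ to _∈ₗ?_)
  open Saturation _∈ₗ_ _∈ₗ?_ (decode {n}) decode-surjective step ∈-++⁺ˡ step-monotone

  saturated : List (Subset n)
  saturated = iter step generators (2 ^ n)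

  InSat⇒∈saturated : InSat μ Unary.⊆ (_∈ₗ saturated)
  InSat⇒∈saturated sat-one       = iter-inflationary generators (2 ^ n) (here refl)
  InSat⇒∈saturated (sat-μ a)     =
    iter-inflationary generators (2 ^ n) (there (∈-map⁺ (λ a → ⁅ μ a ⁆) (∈-allFin a)))
  InSat⇒∈saturated (sat-· p q)   =
    iter-closed generators (∈-step-· (InSat⇒∈saturated p) (InSat⇒∈saturated q))
  InSat⇒∈saturated (sat-ω p)     = iter-closed generators (∈-step-ω (InSat⇒∈saturated p))
  InSat⇒∈saturated (sat-merge p) = iter-closed generators (∈-step-merge (InSat⇒∈saturated p))

  Sat-finite : IsFinite _≈S_
  Sat-finite = listed⇒finite saturated (iter-step-sound (2 ^ n)) InSat⇒∈saturated

  proj₁-pow : ∀ X e → proj₁ (pow oneS _·S_ X e) ≡ powP (proj₁ X) e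
  proj₁-pow X zero    = refl
  proj₁-pow X (suc e) = cong (proj₁ X ·P_) (proj₁-pow X e)

  proj₁-idemPlus : ∀ {X k Y} → IsIdemPlus _≈S_ oneS _·S_ X k Y →
                   IsIdemPlus _≡_ oneP _·P_ (proj₁ X) k (proj₁ Y)
  proj₁-idemPlus {X} (m₀ , Xᵉ≈Y) = m₀ , λ m m₀≤m e e≡ → trans (sym (proj₁-pow X e)) (Xᵉ≈Y m m₀≤m e e≡)

  isFiniteOrdinalMonoidWithMerge :
    IsFiniteOrdinalMonoidWithMerge _≈S_ _⊆S_ oneS _·S_ ωS mergeS
  isFiniteOrdinalMonoidWithMerge = record
    { isFiniteOrdinalMonoid = record
      { isEquivalence = On.isEquivalence proj₁ isEquivalence
      ; ∙-cong        = cong₂ _·P_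
      ; ω-cong        = cong ωP
      ; finite        = Sat-finite
      ; assoc         = λ X Y Z → ·P-assoc (proj₁ X) (proj₁ Y) (proj₁ Z)
      ; identityˡ     = ·P-identityˡ ∘ proj₁
      ; identityʳ     = ·P-identityʳ ∘ proj₁
      ; ω-swap        = λ X Y → ωP-swap (proj₁ X) (proj₁ Y)
      ; ω-pow         = λ X k → trans (cong ωP (proj₁-pow X (suc k))) (ωP-pow (proj₁ X) k)
      ; ω-one         = ωP-one
      }
    ; isPartialOrder = On.isPartialOrder proj₁ (⊆-isPartialOrder n)
    ; ∙-mono         = ·P-mono
    ; ω-mono         = ωP-mono
    ; merge-cong     = cong mergeP
    ; merge-mono     = mergeP-mono
    ; idemPlus≤merge = λ X k Y idem → idemPlus⊆mergeP (proj₁ X) k (proj₁ Y) (proj₁-idemPlus {X} {k} {Y} idem)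
    ; merge-idem     = λ X E idem → idempotent⇒mergeP≡ (idem-idempotent (proj₁ X) (proj₁ E) (proj₁-idemPlus {X} {+ 0} {E} idem))
    ; merge-∙-merge  = mergeP-∙-mergeP ∘ proj₁
    ; merge-merge    = mergeP-mergeP ∘ proj₁
    ; merge-shift    = λ X Y → mergeP-shift (proj₁ X) (proj₁ Y)
    }


mainTheorem9 : {n m : ℕ} (M : FiniteOrdinalMonoid n) (μ : Fin m → Fin n) →
    IsFiniteOrdinalMonoidWithMerge _≡_ _⊆_ (Power.oneP M) (Power._·P_ M) (Power.ωP M) (Power.mergeP M)
    × IsFiniteOrdinalMonoidWithMerge (Power.SatStr._≈S_ M μ) (Power.SatStr._⊆S_ M μ) (Power.SatStr.oneS M μ) (Power.SatStr._·S_ M μ) (Power.SatStr.ωS M μ) (Power.SatStr.mergeS M μ)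
mainTheorem9 M μ =
  PowerProperties.isFiniteOrdinalMonoidWithMerge M , SatProperties.isFiniteOrdinalMonoidWithMerge M μ
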